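{- Let $\ell \in \mathbb{Z}_{\geq 0}$ and $m \in \mathbb{Z}$, and let $\chi_{8,0}$ denote the principal character modulo $8$. Then \[ \Lambda_{\ell,m,8}\vert U_4\otimes\chi_{8,0} = \begin{cases} 2^{\ell+1}G_{\ell,1,4}\vert S_{8,7}&\text{if }m \equiv 0 \pmod{8},\\ 0&\text{if }m \equiv 1,3,5,7 \pmod{8},\\ 2^\ell G_{\ell,1,4}\vert S_{4,1}+2^{\ell-1}T_{\ell,1,4}&\text{if }m \equiv 2, 6 \pmod{8},\\ 2^{\ell+1}G_{\ell,1,4}\vert S_{8,3}&\text{if }m \equiv 4 \pmod{8}, \end{cases} \] where $\Lambda\vert U_4\otimes\chi$ means $(\Lambda\vert U_4)\otimes\chi$.
   Context: Write $q = e^{2\pi i\tau}$. For $F = \sum_n a(n)q^n$: $F\vert U_M := \sum_n a(Mn)q^n$; for a Dirichlet character $\psi$, $F\otimes\psi := \sum_n \psi(n)a(n)q^n$; the sieving operator is $F\vert S_{M,m} := \sum_{n \in \mathbb{Z}} a(Mn+m)q^{Mn+m}$. For $\ell\in\mathbb{Z}_{\geq0}$, $m\in\mathbb{Z}$, $M\in\mathbb{Z}_{\geq1}$: $\Lambda_{\ell,m,M}(\tau) := \sum_{n\geq1}\lambda_{\ell,m,M}(n)q^n$ with $\lambda_{\ell,m,M}(n) := \sum_{\pm}\sum^{*}(t-s)^\ell$, where the inner sum is over integers $t>s\geq 0$ with $t^2-s^2=n$ and $t\equiv \pm m \pmod M$, the outer sum is over the two signs, and the $*$ means that terms with $s=0$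 are counted with weight $\frac12$. Further $G_{\ell,m,M}(\tau) := \sum_{n\geq 1} g_{\ell,m,M}(n)q^n$ with $g_{\ell,m,M}(n) := \sum_{\pm}\sum_{d \mid n,\ 0<d<\sqrt{n},\ d\equiv \pm m \pmod{M}} d^\ell$, and $T_{\ell,m,M}(\tau) := \sum_{\pm}\sum_{n\geq 1,\ n \equiv \pm m \pmod{M}} n^\ell q^{n^2}$. -}

module Defs where

open import Data.Nat as ℕ using (ℕ; zero; suc; _<_; _<?_)
open import Data.Nat.Divisibility as ℕD using (_∣?_)
open import Data.Integer as ℤ using (ℤ; +_; ∣_∣)
open import Data.Rational as ℚ using (ℚ; 0ℚ; 1ℚ; ½; _+_; _*_)
open import Data.List using (List; upTo; map; sum; foldr)
open import Relation.Nullary using (does)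
open import Data.Bool using (Bool; true; false; if_then_else_; _∧_)

-- A formal q-series  Σ_{n ≥ 0} a(n) qⁿ  is represented by its coefficient
-- function  a : ℕ → ℚ.  (All series in this statement have only n ≥ 1 terms;
-- negative-index coefficients are zero, so ℕ-indexing loses nothing.)
Series : Set
Series = ℕ → ℚ

ℕtoℚ : ℕ → ℚ
ℕtoℚ k = (+ k) ℚ./ 1

Σ< : ℕ → (ℕ → ℚ) → ℚ
Σ< n f = foldr (λ i acc → f i + acc) 0ℚ (upTo n)

_≡_[mod_] : ℤ → ℤ → ℕ → Bool
a ≡ b [mod M ] = does (M ∣? ∣ a ℤ.- b ∣)

-- x ≡ ±m (mod M): returns the contribution for each sign, summed over both
-- signs (so if m ≡ -m the term is counted twice, as in Σ_±).
Σ± : ℕ → ℤ → ℕ → ℚ → ℚ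
Σ± x m M v =
  (if (+ x) ≡ m [mod M ] then v else 0ℚ) + (if (+ x) ≡ ℤ.- m [mod M ] then v else 0ℚ)

-- λ_{ℓ,m,M}(n) = Σ_± Σ* (t-s)^ℓ over t > s ≥ 0, t² - s² = n, t ≡ ±m (mod M),
-- with s = 0 terms weighted 1/2.  For n ≥ 1 such t satisfy t ≤ n, so
-- enumerating t < n+1 is exhaustive.  λ(0) := 0 (Λ has only n ≥ 1 terms).
lam : ℕ → ℤ → ℕ → Series
lam ℓ m M zero = 0ℚ
lam ℓ m M (suc k) =
  Σ< (suc (suc k)) λ t → Σ< t λ s →
    if does (t ℕ.* t ℕ.≟ s ℕ.* s ℕ.+ suc k)
    then Σ± t m M ((if does (s ℕ.≟ 0) then ½ else 1ℚ) * ℕtoℚ ((t ℕ.∸ s) ℕ.^ ℓ))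
    else 0ℚ

Λ : ℕ → ℤ → ℕ → Series
Λ = lam

-- g_{ℓ,m,M}(n) = Σ_± Σ_{d ∣ n, 0 < d < √n, d ≡ ±m (mod M)} d^ℓ ;  g(0) := 0.
-- (0 < d < √n  ⇔  0 < d ∧ d·d < n.)
G : ℕ → ℤ → ℕ → Series
G ℓ m M zero = 0ℚ
G ℓ m M (suc k) =
  Σ< (suc (suc k)) λ d →
    if does (0 <? d) ∧ does (d ∣? suc k) ∧ does (d ℕ.* d <? suc k)
    then Σ± d m M (ℕtoℚ (d ℕ.^ ℓ))
    else 0ℚ

-- T_{ℓ,m,M} = Σ_± Σ_{n ≥ 1, n ≡ ±m (M)} n^ℓ q^{n²};  coefficient of q^k.
-- (n² = k forces n ≤ k, so enumerating n < k+1 is exhaustive.)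
T : ℕ → ℤ → ℕ → Series
T ℓ m M k =
  Σ< (suc k) λ n →
    if does (0 <? n) ∧ does (n ℕ.* n ℕ.≟ k)
    then Σ± n m M (ℕtoℚ (n ℕ.^ ℓ))
    else 0ℚ

_∣U_ : Series → ℕ → Series
(F ∣U M) n = F (M ℕ.* n)

χ₈₀ : ℕ → ℚ
χ₈₀ n = if does (2 ∣? n) then 0ℚ else 1ℚ

_⊗χ₈₀ : Series → Series
(F ⊗χ₈₀) n = χ₈₀ n * F n

_∣S[_,_] : Series → ℕ → ℤ → Series
(F ∣S[ M , r ]) n = if (+ n) ≡ r [mod M ] then F n else 0ℚ

-- 2^ℓ and 2^(ℓ-1) = 2^ℓ / 2 in ℚ (note 2^(0-1) = 1/2)
pow2 : ℕ → ℚ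
pow2 ℓ = ℕtoℚ (2 ℕ.^ ℓ)

pow2m1 : ℕ → ℚ
pow2m1 ℓ = ½ * pow2 ℓ

{-# OPTIONS --safe #-}
module Submission where

-- For n ≥ 1 the representations 4n = t² - s² with 0 ≤ s < t are exactly t = d + e, s = e - d for the
-- factorisations n = d e with d ≤ e, the case d = e = j (s = 0) occurring iff n = j². So λ(4n) is a sum
-- over the divisors d < √n of (2d)^ℓ, weighted by the number of signs with d + n/d ≡ ±m (mod 8), plus
-- ½ (2j)^ℓ weighted likewise when n = j². For odd n both factors are odd, and then the class of d + e
-- mod 8 is read off from d e: d + e ≡ 0 iff d e ≡ 7, d + e ≡ 4 iff d e ≡ 3 (mod 8), and d + e ≡ ±2 (mod 8)
-- iff d e ≡ 1 (mod 4); moreover odd squares are 1 mod 8 and every odd d satisfies exactly one of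
-- d ≡ ±1 (mod 4). Comparing term by term with G_{ℓ,1,4} and T_{ℓ,1,4} gives the four cases; χ₈₀ kills
-- the even n, where the right-hand sides vanish as well.

open import Defs
open import Data.Bool using (Bool; true; false; if_then_else_; _∨_)
import Data.Bool.Properties as Bool
open import Data.Empty using (⊥; ⊥-elim)
open import Data.Nat as ℕ using (ℕ; zero; suc; NonZero; _<_; _≤_; z<s; s<s; _≟_; _<?_; _∸_; _^_; >-nonZero; >-nonZero⁻¹)
open import Data.Nat.DivMod using (_%_; _/_; m≡m%n+[m/n]*n; m%n<n; %-distribˡ-+; %-distribˡ-*; m*n/n≡m; m*[n/m]≡n)
open import Data.Nat.Divisibility
  using (_∣_; _∣?_; divides; ∣-refl; ∣-trans; ∣n⇒∣m*n; ∣m⇒∣m*n; m∣m*n; ∣m∣n⇒∣m+n; ∣m+n∣m⇒∣n; ∣⇒≤; m%n≡0⇒n∣m)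
open import Data.Nat.Primality using (euclidsLemma; prime[2])
open import Data.Nat.Properties using (allUpTo?; suc-injective)
import Data.Nat.Properties as ℕ
open import Data.Integer as ℤ using (ℤ; +_; ∣_∣)
import Data.Integer.Properties as ℤ
open import Data.Integer.DivMod using (_%ℕ_)
open import Data.Product using (_×_; _,_; proj₁; proj₂; ∃₂; uncurry)
open import Data.Sum using (_⊎_; inj₁; inj₂; [_,_]′)
open import Function using (_∘_; id)
open import Function.Bundles using (mk⇔)
open import Relation.Nullary using (¬_; Dec; yes; no; does; ¬?; _×-dec_; _→-dec_)
open import Relation.Nullary.Decidable using (does-⇔; dec-true; dec-false; True; toWitness; toSum; from-no)
open import Relation.Binary.PropositionalEquality
open ≡-Reasoning

dec-true⁻¹ : ∀ {A : Set} (a? : Dec A) → does a? ≡ true → A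
dec-true⁻¹ (yes a) _ = a

-- Representations 4n = t² - s²

module _ where
  open import Data.Nat using (_+_; _*_)
  open import Data.Nat.Properties
    using ( *-comm; +-comm; +-identityʳ; m+n∸m≡n; m+[n∸m]≡n; m≤m+n; m≤n*m; *-cancelˡ-≡; +-cancelˡ-≡
          ; ≮⇒≥; <⇒≱; *-mono-<; *-monoʳ-≤; *-monoʳ-<; m<m+n; ≤-trans)
  open import Data.Nat.Tactic.RingSolver using (solve-∀)

  square-of-s+2d : ∀ s d → (s + 2 * d) * (s + 2 * d) ≡ s * s + 4 * (d * (d + s))
  square-of-s+2d = solve-∀

  half-gap : ℕ → ℕ → ℕ
  half-gap t s = (t ∸ s) / 2

  half-gap-s+2d : ∀ s d → half-gap (s + 2 * d) s ≡ d
  half-gap-s+2d s d = trans (cong (_/ 2) (trans (m+n∸m≡n s (2 * d)) (*-comm 2 d))) (m*n/n≡m d 2)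

  -- 4 ∣ t² - s² forces t ≡ s (mod 2), so t = s + 2d and then n = d (d + s).
  representation⇒factorisation : ∀ {t s n} → t * t ≡ s * s + 4 * n →
                                 t ≡ s + 2 * half-gap t s × half-gap t s * (half-gap t s + s) ≡ n
  representation⇒factorisation {t} {s} {n} t²≡s²+4n = t≡s+2d , *-cancelˡ-≡ (d * (d + s)) n 4 (+-cancelˡ-≡ (s * s) _ _ (begin
    s * s + 4 * (d * (d + s)) ≡⟨ square-of-s+2d s d ⟨
    (s + 2 * d) * (s + 2 * d) ≡⟨ cong (λ x → x * x) t≡s+2d ⟨
    t * t                     ≡⟨ t²≡s²+4n ⟩
    s * s + 4 * n             ∎))
    where
    square-of-s+u : ∀ s u → (s + u) * (s + u) ≡ s * s + u * (u + 2 * s)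
    square-of-s+u = solve-∀
    d = half-gap t s
    s≤t : s ≤ t
    s≤t = ≮⇒≥ λ t<s → <⇒≱ (*-mono-< t<s t<s) (subst (s * s ≤_) (sym t²≡s²+4n) (m≤m+n (s * s) (4 * n)))
    u = t ∸ s
    t≡s+u : t ≡ s + u
    t≡s+u = sym (m+[n∸m]≡n s≤t)
    u[u+2s]≡4n : u * (u + 2 * s) ≡ 4 * n
    u[u+2s]≡4n = +-cancelˡ-≡ (s * s) (u * (u + 2 * s)) (4 * n) (begin
      s * s + u * (u + 2 * s) ≡⟨ square-of-s+u s u ⟨
      (s + u) * (s + u)       ≡⟨ cong (λ x → x * x) t≡s+u ⟨
      t * t                   ≡⟨ t²≡s²+4n ⟩
      s * s + 4 * n           ∎)
    2∣u : 2 ∣ u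
    2∣u = [ id , (λ 2∣u+2s → ∣m+n∣m⇒∣n (subst (2 ∣_) (+-comm u (2 * s)) 2∣u+2s) (m∣m*n s)) ]′
            (euclidsLemma u (u + 2 * s) prime[2] (subst (2 ∣_) (sym u[u+2s]≡4n) (∣m⇒∣m*n n (divides 2 refl))))
    t≡s+2d : t ≡ s + 2 * d
    t≡s+2d = trans t≡s+u (cong (_+_ s) (sym (m*[n/m]≡n 2∣u)))

  factorisation⇒representation : ∀ {d s n} → 0 < d → d * (d + s) ≡ n →
                                 s < s + 2 * d × s + 2 * d < suc (4 * n) × (s + 2 * d) * (s + 2 * d) ≡ s * s + 4 * n
  factorisation⇒representation {d} {s} 0<d refl = m<m+n s (*-monoʳ-< 2 0<d) , s<s t≤4n , square-of-s+2d s d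
    where
    identity : ∀ s d → s + 2 * d + (2 * d + 3 * s) ≡ 4 * (d + s)
    identity = solve-∀
    t≤4n : s + 2 * d ≤ 4 * (d * (d + s))
    t≤4n = ≤-trans (subst (s + 2 * d ≤_) (identity s d) (m≤m+n (s + 2 * d) (2 * d + 3 * s)))
                   (*-monoʳ-≤ 4 (m≤n*m (d + s) d {{>-nonZero 0<d}}))

  factor-positive : ∀ {d k n} .{{_ : NonZero n}} → d * k ≡ n → 0 < d
  factor-positive {zero}  refl = >-nonZero⁻¹ 0
  factor-positive {suc _} _    = z<s

  half-gap-injective : ∀ {t s t′ s′ n} .{{_ : NonZero n}} → t * t ≡ s * s + 4 * n → t′ * t′ ≡ s′ * s′ + 4 * n →
                       half-gap t s ≡ half-gap t′ s′ → t ≡ t′ × s ≡ s′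
  half-gap-injective {t} {s} {t′} {s′} {n} t²≡ t′²≡ d≡d′ = t≡t′ , s≡s′
    where
    d = half-gap t s
    rep = representation⇒factorisation {t} {s} {n} t²≡
    rep′ = representation⇒factorisation {t′} {s′} {n} t′²≡
    s≡s′ : s ≡ s′
    s≡s′ = +-cancelˡ-≡ d s s′ (*-cancelˡ-≡ (d + s) (d + s′) d {{>-nonZero (factor-positive {d} {d + s} (proj₂ rep))}}
             (trans (proj₂ rep) (sym (subst (λ x → x * (x + s′) ≡ n) (sym d≡d′) (proj₂ rep′)))))
    t≡t′ : t ≡ t′
    t≡t′ = trans (proj₁ rep) (trans (cong₂ (λ a b → a + 2 * b) s≡s′ d≡d′) (sym (proj₁ rep′)))

  s+2d≡d+[d+s] : ∀ s d → s + 2 * d ≡ d + (d + s)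
  s+2d≡d+[d+s] = solve-∀

  ^-distrib-* : ∀ a b ℓ → (a * b) ^ ℓ ≡ a ^ ℓ * b ^ ℓ
  ^-distrib-* a b zero    = refl
  ^-distrib-* a b (suc ℓ) = trans (cong (_*_ (a * b)) (^-distrib-* a b ℓ)) (interchange a b (a ^ ℓ) (b ^ ℓ))
    where
    interchange : ∀ a b x y → (a * b) * (x * y) ≡ (a * x) * (b * y)
    interchange = solve-∀

  odd⇒nonZero : ∀ {n} → ¬ 2 ∣ n → NonZero n
  odd⇒nonZero {zero}  2∤0 = ⊥-elim (2∤0 (divides 0 refl))
  odd⇒nonZero {suc _} _   = >-nonZero z<s

  odd-factors : ∀ {d e n} → ¬ 2 ∣ n → d * e ≡ n → (¬ 2 ∣ d) × (¬ 2 ∣ e)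
  odd-factors {d} {e} 2∤n de≡n = 2∤n ∘ subst (2 ∣_) de≡n ∘ ∣m⇒∣m*n e , 2∤n ∘ subst (2 ∣_) de≡n ∘ ∣n⇒∣m*n d

  odd-%2 : ∀ {d} → ¬ 2 ∣ d → d % 2 ≡ 1
  odd-%2 {d} 2∤d with d % 2 in d%2≡ | m%n<n d 2
  ... | 0           | _               = ⊥-elim (2∤d (m%n≡0⇒n∣m d 2 d%2≡))
  ... | 1           | _               = refl
  ... | suc (suc _) | s<s (s<s ())

  odd+odd : ∀ {d e} → ¬ 2 ∣ d → ¬ 2 ∣ e → 2 ∣ d + e
  odd+odd {d} {e} 2∤d 2∤e = m%n≡0⇒n∣m (d + e) 2 (begin
    (d + e) % 2           ≡⟨ %-distribˡ-+ d e 2 ⟩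
    (d % 2 + e % 2) % 2   ≡⟨ cong₂ (λ a b → (a + b) % 2) (odd-%2 2∤d) (odd-%2 2∤e) ⟩
    0                     ∎)

  odd-%8 : ∀ {d} → ¬ 2 ∣ d → ¬ 2 ∣ d % 8
  odd-%8 {d} 2∤d 2∣d%8 = 2∤d (subst (2 ∣_) (sym (m≡m%n+[m/n]*n d 8)) (∣m∣n⇒∣m+n 2∣d%8 (∣n⇒∣m*n (d / 8) (divides 4 refl))))

-- Congruences and residues

module _ where
  open import Data.Integer using (_+_; _-_; -_; _*_)
  open import Data.Integer.Properties using (pos-+; +-inverseʳ)
  open import Data.Integer.DivMod using (_/ℕ_; a≡a%ℕn+[a/ℕn]*n)
  import Data.Integer.Divisibility.Signed as ℤ∣
  open import Data.Integer.Tactic.RingSolver using (solve-∀)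

  -- A record rather than a synonym for M ∣ ∣ a - b ∣, so that a and b can be inferred from it.
  infix 4 _≈_[mod_]
  record _≈_[mod_] (a b : ℤ) (M : ℕ) : Set where
    constructor congruent
    field divides-difference : M ∣ ∣ a - b ∣

  private
    signed : ∀ {a b M} → a ≈ b [mod M ] → + M ℤ∣.∣ a - b
    signed (congruent M∣a-b) = ℤ∣.∣ᵤ⇒∣ M∣a-b

    unsigned : ∀ {a b M} → + M ℤ∣.∣ a - b → a ≈ b [mod M ]
    unsigned M∣a-b = congruent (ℤ∣.∣⇒∣ᵤ M∣a-b)

  ≈-refl : ∀ {a M} → a ≈ a [mod M ]
  ≈-refl {a} = congruent (subst (λ k → _ ∣ ∣ k ∣) (sym (+-inverseʳ a)) (divides 0 refl))

  ≈-sym : ∀ {a b M} → a ≈ b [mod M ] → b ≈ a [mod M ]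
  ≈-sym {a} {b} {M} a≈b = unsigned (subst (+ M ℤ∣.∣_) (identity a b) (ℤ∣.∣m⇒∣-m (signed a≈b)))
    where
    identity : ∀ a b → - (a - b) ≡ b - a
    identity = solve-∀

  ≈-trans : ∀ {a b c M} → a ≈ b [mod M ] → b ≈ c [mod M ] → a ≈ c [mod M ]
  ≈-trans {a} {b} {c} {M} a≈b b≈c = unsigned (subst (+ M ℤ∣.∣_) (identity a b c) (ℤ∣.∣m∣n⇒∣m+n (signed a≈b) (signed b≈c)))
    where
    identity : ∀ a b c → (a - b) + (b - c) ≡ a - c
    identity = solve-∀

  ≈-neg : ∀ {a b M} → a ≈ b [mod M ] → - a ≈ - b [mod M ]
  ≈-neg {a} {b} {M} a≈b = unsigned (subst (+ M ℤ∣.∣_) (identity a b) (ℤ∣.∣m⇒∣-m (signed a≈b)))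
    where
    identity : ∀ a b → - (a - b) ≡ - a - - b
    identity = solve-∀

  %-congruent : ∀ {M N} x .{{_ : NonZero N}} → M ∣ N → + x ≈ + (x % N) [mod M ]
  %-congruent {M} {N} x M∣N = subst (λ y → + y ≈ + (x % N) [mod M ]) (sym (m≡m%n+[m/n]*n x N))
    (congruent (subst (λ k → M ∣ ∣ k ∣) (sym (begin
      + (x % N ℕ.+ (x / N) ℕ.* N) - + (x % N)     ≡⟨ cong (_- + (x % N)) (pos-+ (x % N) ((x / N) ℕ.* N)) ⟩
      (+ (x % N) + + ((x / N) ℕ.* N)) - + (x % N) ≡⟨ identity (+ (x % N)) (+ ((x / N) ℕ.* N)) ⟩
      + ((x / N) ℕ.* N)                           ∎))
      (∣n⇒∣m*n (x / N) M∣N)))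
    where
    identity : ∀ r q → (r + q) - r ≡ q
    identity = solve-∀

  %ℕ-congruent : ∀ m M .{{_ : NonZero M}} → m ≈ + (m %ℕ M) [mod M ]
  %ℕ-congruent m M = subst (λ k → k ≈ + (m %ℕ M) [mod M ]) (sym (a≡a%ℕn+[a/ℕn]*n m M))
    (unsigned (subst (+ M ℤ∣.∣_) (sym (identity (+ (m %ℕ M)) ((m /ℕ M) * + M))) (ℤ∣.∣n⇒∣m*n (m /ℕ M) ℤ∣.∣-refl)))
    where
    identity : ∀ r q → (r + q) - r ≡ q
    identity = solve-∀

  ≡[mod]-cong : ∀ {a a′ b b′ M} → a ≈ a′ [mod M ] → b ≈ b′ [mod M ] → (a ≡ b [mod M ]) ≡ (a′ ≡ b′ [mod M ])
  ≡[mod]-cong {a} {a′} {b} {b′} {M} a≈a′ b≈b′ =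
    does-⇔ (mk⇔ (transfer a≈a′ b≈b′) (transfer (≈-sym a≈a′) (≈-sym b≈b′))) (M ∣? ∣ a - b ∣) (M ∣? ∣ a′ - b′ ∣)
    where
    transfer : ∀ {a a′ b b′} → a ≈ a′ [mod M ] → b ≈ b′ [mod M ] → M ∣ ∣ a - b ∣ → M ∣ ∣ a′ - b′ ∣
    transfer a≈a′ b≈b′ M∣a-b = _≈_[mod_].divides-difference (≈-trans (≈-sym a≈a′) (≈-trans (congruent M∣a-b) b≈b′))

  ≡[mod]-sound : ∀ {a b M} → (a ≡ b [mod M ]) ≡ true → a ≈ b [mod M ]
  ≡[mod]-sound {a} {b} {M} = congruent ∘ dec-true⁻¹ (M ∣? ∣ a - b ∣)

  ≡[mod]-% : ∀ M N .{{_ : NonZero N}} c → M ∣ N → ∀ x → ((+ (x % N)) ≡ c [mod M ]) ≡ ((+ x) ≡ c [mod M ])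
  ≡[mod]-% M N c M∣N x = ≡[mod]-cong (≈-sym (%-congruent x M∣N)) (≈-refl {c})

  ≡[mod]-parity : ∀ {M x c} → 2 ∣ M → 2 ∣ x → ¬ 2 ∣ ∣ c ∣ → ((+ x) ≡ c [mod M ]) ≡ false
  ≡[mod]-parity {M} {x} {c} 2∣M 2∣x 2∤c = dec-false (M ∣? ∣ + x - c ∣) λ M∣x-c →
    2∤c (ℤ∣.∣⇒∣ᵤ (subst (+ 2 ℤ∣.∣_) (identity (+ x) c)
      (ℤ∣.∣m∣n⇒∣m-n (ℤ∣.∣ᵤ⇒∣ {i = + x} 2∣x) (ℤ∣.∣ᵤ⇒∣ {i = + x - c} (∣-trans 2∣M M∣x-c)))))
    where
    identity : ∀ x c → x - (x - c) ≡ c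
    identity = solve-∀

-- The `True` argument is discharged by evaluation: the law is checked on all pairs of odd residues mod 8.
odd-pair-law : (p q : ℕ → Bool) → (∀ x → p (x % 8) ≡ p x) → (∀ x → q (x % 8) ≡ q x) →
  True (allUpTo? (λ a → allUpTo? (λ b → ¬? (2 ∣? a) →-dec ¬? (2 ∣? b) →-dec (p (a ℕ.+ b) Bool.≟ q (a ℕ.* b))) 8) 8) →
  ∀ {d e} → ¬ 2 ∣ d → ¬ 2 ∣ e → p (d ℕ.+ e) ≡ q (d ℕ.* e)
odd-pair-law p q p-%8 q-%8 residues {d} {e} 2∤d 2∤e = begin
  p (d ℕ.+ e)                   ≡⟨ p-%8 (d ℕ.+ e) ⟨
  p ((d ℕ.+ e) % 8)             ≡⟨ cong p (%-distribˡ-+ d e 8) ⟩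
  p ((d % 8 ℕ.+ e % 8) % 8)     ≡⟨ p-%8 (d % 8 ℕ.+ e % 8) ⟩
  p (d % 8 ℕ.+ e % 8)           ≡⟨ toWitness residues (m%n<n d 8) (m%n<n e 8) (odd-%8 2∤d) (odd-%8 2∤e) ⟩
  q (d % 8 ℕ.* (e % 8))         ≡⟨ q-%8 (d % 8 ℕ.* (e % 8)) ⟨
  q ((d % 8 ℕ.* (e % 8)) % 8)   ≡⟨ cong q (%-distribˡ-* d e 8) ⟨
  q ((d ℕ.* e) % 8)             ≡⟨ q-%8 (d ℕ.* e) ⟩
  q (d ℕ.* e)                   ∎

odd-residue-law : ∀ {P : ℕ → Set} (P? : ∀ a → Dec (P a)) →
  True (allUpTo? (λ a → ¬? (2 ∣? a) →-dec P? a) 8) → ∀ {d} → ¬ 2 ∣ d → P (d % 8)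
odd-residue-law P? residues {d} 2∤d = toWitness residues (m%n<n d 8) (odd-%8 2∤d)

odd-pair-sum≡0[mod8] : ∀ {d e} → ¬ 2 ∣ d → ¬ 2 ∣ e → ((+ (d ℕ.+ e)) ≡ + 0 [mod 8 ]) ≡ ((+ (d ℕ.* e)) ≡ + 7 [mod 8 ])
odd-pair-sum≡0[mod8] = odd-pair-law _ _ (≡[mod]-% 8 8 (+ 0) ∣-refl) (≡[mod]-% 8 8 (+ 7) ∣-refl) _

odd-pair-sum≡4[mod8] : ∀ {d e} → ¬ 2 ∣ d → ¬ 2 ∣ e → ((+ (d ℕ.+ e)) ≡ + 4 [mod 8 ]) ≡ ((+ (d ℕ.* e)) ≡ + 3 [mod 8 ])
odd-pair-sum≡4[mod8] = odd-pair-law _ _ (≡[mod]-% 8 8 (+ 4) ∣-refl) (≡[mod]-% 8 8 (+ 3) ∣-refl) _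

odd-pair-sum≡±2[mod8] : ∀ {d e} → ¬ 2 ∣ d → ¬ 2 ∣ e →
  ((+ (d ℕ.+ e)) ≡ + 2 [mod 8 ] ∨ (+ (d ℕ.+ e)) ≡ ℤ.- + 2 [mod 8 ]) ≡ ((+ (d ℕ.* e)) ≡ + 1 [mod 4 ])
odd-pair-sum≡±2[mod8] = odd-pair-law _ _
  (λ x → cong₂ _∨_ (≡[mod]-% 8 8 (+ 2) ∣-refl x) (≡[mod]-% 8 8 (ℤ.- + 2) ∣-refl x))
  (≡[mod]-% 4 8 (+ 1) (divides 2 refl)) _

odd-square : ∀ {j} → ¬ 2 ∣ j → (j ℕ.* j) % 8 ≡ 1
odd-square {j} 2∤j = trans (%-distribˡ-* j j 8) (odd-residue-law (λ a → (a ℕ.* a) % 8 ≟ 1) _ 2∤j)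

odd≡±1[mod4] : ∀ {d} → ¬ 2 ∣ d → ((+ d) ≡ + 1 [mod 4 ] ∨ (+ d) ≡ ℤ.- + 1 [mod 4 ]) ≡ true
odd≡±1[mod4] {d} 2∤d = trans (sym (cong₂ _∨_ (≡[mod]-% 4 8 (+ 1) (divides 2 refl) d) (≡[mod]-% 4 8 (ℤ.- + 1) (divides 2 refl) d)))
  (odd-residue-law (λ a → ((+ a) ≡ + 1 [mod 4 ] ∨ (+ a) ≡ ℤ.- + 1 [mod 4 ]) Bool.≟ true) _ 2∤d)

odd-square-≡[mod] : ∀ {j M c} → ¬ 2 ∣ j → M ∣ 8 → ((+ (j ℕ.* j)) ≡ c [mod M ]) ≡ ((+ 1) ≡ c [mod M ])
odd-square-≡[mod] {j} {M} {c} 2∤j M∣8 = trans (sym (≡[mod]-% M 8 c M∣8 (j ℕ.* j))) (cong (λ k → (+ k) ≡ c [mod M ]) (odd-square 2∤j))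

open import Data.Rational as ℚ using (ℚ; 0ℚ; 1ℚ; ½; _+_; _*_)
import Data.Rational.Properties as ℚ
import Data.Rational.Unnormalised as ℚᵘ
import Data.Rational.Unnormalised.Properties as ℚᵘ
open import Data.List using (upTo; applyUpTo; map; foldr)
open import Data.List.Properties using (map-applyUpTo; foldr-map)
open import Algebra.Bundles using (CommutativeMonoid)
open import Algebra.Properties.CommutativeSemigroup (CommutativeMonoid.commutativeSemigroup ℚ.+-0-commutativeMonoid)
  using (interchange)

-- Finite sums

Σ<-suc : ∀ n (f : ℕ → ℚ) → Σ< (suc n) f ≡ f 0 + Σ< n (f ∘ suc)
Σ<-suc n f = cong (_+_ (f 0)) (begin
  foldr (λ i acc → f i + acc) 0ℚ (applyUpTo suc n)    ≡⟨ cong (foldr _ 0ℚ) (map-applyUpTo id suc n) ⟨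
  foldr (λ i acc → f i + acc) 0ℚ (map suc (upTo n))   ≡⟨ foldr-map _ suc 0ℚ (upTo n) ⟩
  Σ< n (f ∘ suc)                                      ∎)

Σ<-cong : ∀ n {f g : ℕ → ℚ} → (∀ {i} → i < n → f i ≡ g i) → Σ< n f ≡ Σ< n g
Σ<-cong zero    f≗g = refl
Σ<-cong (suc n) {f} {g} f≗g = begin
  Σ< (suc n) f         ≡⟨ Σ<-suc n f ⟩
  f 0 + Σ< n (f ∘ suc) ≡⟨ cong₂ _+_ (f≗g z<s) (Σ<-cong n (f≗g ∘ s<s)) ⟩
  g 0 + Σ< n (g ∘ suc) ≡⟨ Σ<-suc n g ⟨
  Σ< (suc n) g         ∎

Σ<-zero : ∀ n {f : ℕ → ℚ} → (∀ {i} → i < n → f i ≡ 0ℚ) → Σ< n f ≡ 0ℚ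
Σ<-zero zero    f≗0 = refl
Σ<-zero (suc n) {f} f≗0 = begin
  Σ< (suc n) f         ≡⟨ Σ<-suc n f ⟩
  f 0 + Σ< n (f ∘ suc) ≡⟨ cong₂ _+_ (f≗0 z<s) (Σ<-zero n (f≗0 ∘ s<s)) ⟩
  0ℚ + 0ℚ              ≡⟨ ℚ.+-identityˡ 0ℚ ⟩
  0ℚ                   ∎

Σ<-+ : ∀ n (f g : ℕ → ℚ) → Σ< n (λ i → f i + g i) ≡ Σ< n f + Σ< n g
Σ<-+ zero    f g = refl
Σ<-+ (suc n) f g = begin
  Σ< (suc n) (λ i → f i + g i)                            ≡⟨ Σ<-suc n (λ i → f i + g i) ⟩
  (f 0 + g 0) + Σ< n (λ i → f (suc i) + g (suc i))        ≡⟨ cong (_+_ (f 0 + g 0)) (Σ<-+ n (f ∘ suc) (g ∘ suc)) ⟩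
  (f 0 + g 0) + (Σ< n (f ∘ suc) + Σ< n (g ∘ suc))         ≡⟨ interchange (f 0) (g 0) (Σ< n (f ∘ suc)) (Σ< n (g ∘ suc)) ⟩
  (f 0 + Σ< n (f ∘ suc)) + (g 0 + Σ< n (g ∘ suc))         ≡⟨ cong₂ _+_ (Σ<-suc n f) (Σ<-suc n g) ⟨
  Σ< (suc n) f + Σ< (suc n) g                             ∎

Σ<-*ˡ : ∀ n c (f : ℕ → ℚ) → Σ< n (λ i → c * f i) ≡ c * Σ< n f
Σ<-*ˡ zero    c f = sym (ℚ.*-zeroʳ c)
Σ<-*ˡ (suc n) c f = begin
  Σ< (suc n) (λ i → c * f i)            ≡⟨ Σ<-suc n (λ i → c * f i) ⟩
  c * f 0 + Σ< n (λ i → c * f (suc i))  ≡⟨ cong (_+_ (c * f 0)) (Σ<-*ˡ n c (f ∘ suc)) ⟩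
  c * f 0 + c * Σ< n (f ∘ suc)          ≡⟨ ℚ.*-distribˡ-+ c (f 0) (Σ< n (f ∘ suc)) ⟨
  c * (f 0 + Σ< n (f ∘ suc))            ≡⟨ cong (c *_) (Σ<-suc n f) ⟨
  c * Σ< (suc n) f                      ∎

Σ<-comm : ∀ m n (f : ℕ → ℕ → ℚ) → Σ< m (λ i → Σ< n (f i)) ≡ Σ< n (λ j → Σ< m (λ i → f i j))
Σ<-comm zero    n f = sym (Σ<-zero n (λ _ → refl))
Σ<-comm (suc m) n f = begin
  Σ< (suc m) (λ i → Σ< n (f i))                       ≡⟨ Σ<-suc m (λ i → Σ< n (f i)) ⟩
  Σ< n (f 0) + Σ< m (λ i → Σ< n (f (suc i)))          ≡⟨ cong (_+_ (Σ< n (f 0))) (Σ<-comm m n (f ∘ suc)) ⟩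
  Σ< n (f 0) + Σ< n (λ j → Σ< m (λ i → f (suc i) j))  ≡⟨ Σ<-+ n (f 0) (λ j → Σ< m (λ i → f (suc i) j)) ⟨
  Σ< n (λ j → f 0 j + Σ< m (λ i → f (suc i) j))       ≡⟨ Σ<-cong n (λ {j} _ → Σ<-suc m (λ i → f i j)) ⟨
  Σ< n (λ j → Σ< (suc m) (λ i → f i j))               ∎

Σ<-single : ∀ {n k} {f : ℕ → ℚ} → k < n → (∀ {i} → i < n → i ≢ k → f i ≡ 0ℚ) → Σ< n f ≡ f k
Σ<-single {suc n} {zero} {f} _ f≗0 = begin
  Σ< (suc n) f         ≡⟨ Σ<-suc n f ⟩
  f 0 + Σ< n (f ∘ suc) ≡⟨ cong (_+_ (f 0)) (Σ<-zero n (λ i<n → f≗0 (s<s i<n) λ ())) ⟩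
  f 0 + 0ℚ             ≡⟨ ℚ.+-identityʳ (f 0) ⟩
  f 0                  ∎
Σ<-single {suc n} {suc k} {f} (s<s k<n) f≗0 = begin
  Σ< (suc n) f         ≡⟨ Σ<-suc n f ⟩
  f 0 + Σ< n (f ∘ suc) ≡⟨ cong₂ _+_ (f≗0 z<s λ ()) (Σ<-single k<n λ i<n i≢k → f≗0 (s<s i<n) (i≢k ∘ suc-injective)) ⟩
  0ℚ + f (suc k)       ≡⟨ ℚ.+-identityˡ (f (suc k)) ⟩
  f (suc k)            ∎

Σ<Σ<-+ : ∀ A (f g : ℕ → ℕ → ℚ) →
         Σ< A (λ t → Σ< t (λ s → f t s + g t s)) ≡ Σ< A (λ t → Σ< t (f t)) + Σ< A (λ t → Σ< t (g t))
Σ<Σ<-+ A f g = trans (Σ<-cong A (λ {t} _ → Σ<-+ t (f t) (g t))) (Σ<-+ A (λ t → Σ< t (f t)) (λ t → Σ< t (g t)))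

Σ<Σ<-zero : ∀ A {h : ℕ → ℕ → ℚ} → (∀ {t s} → s < t → t < A → h t s ≡ 0ℚ) → Σ< A (λ t → Σ< t (h t)) ≡ 0ℚ
Σ<Σ<-zero A h≗0 = Σ<-zero A (λ {t} t<A → Σ<-zero t (λ s<t → h≗0 s<t t<A))

Σ<Σ<-single : ∀ {A t₀ s₀} {h : ℕ → ℕ → ℚ} → s₀ < t₀ → t₀ < A →
  (∀ {t s} → s < t → t < A → ¬ (t ≡ t₀ × s ≡ s₀) → h t s ≡ 0ℚ) → Σ< A (λ t → Σ< t (h t)) ≡ h t₀ s₀
Σ<Σ<-single {A} {t₀} {s₀} {h} s₀<t₀ t₀<A h≗0 = begin
  Σ< A (λ t → Σ< t (h t)) ≡⟨ Σ<-single t₀<A (λ {t} t<A t≢t₀ → Σ<-zero t (λ s<t → h≗0 s<t t<A (t≢t₀ ∘ proj₁))) ⟩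
  Σ< t₀ (h t₀)            ≡⟨ Σ<-single s₀<t₀ (λ s<t₀ s≢s₀ → h≗0 s<t₀ t₀<A (s≢s₀ ∘ proj₂)) ⟩
  h t₀ s₀                 ∎

if-yes : ∀ {A : Set} (a? : Dec A) {x y : ℚ} → A → (if does a? then x else y) ≡ x
if-yes a? a rewrite dec-true a? a = refl

if-no : ∀ {A : Set} (a? : Dec A) {x y : ℚ} → ¬ A → (if does a? then x else y) ≡ y
if-no a? ¬a rewrite dec-false a? ¬a = refl

if-split : ∀ {A B : Set} (a? : Dec A) (b? : Dec B) {x : ℚ} →
  (if does a? then x else 0ℚ) ≡ (if does (a? ×-dec ¬? b?) then x else 0ℚ) + (if does (a? ×-dec b?) then x else 0ℚ)
if-split (yes _) (yes _) {x} = sym (ℚ.+-identityˡ x)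
if-split (yes _) (no _)  {x} = sym (ℚ.+-identityʳ x)
if-split (no _)  _           = sym (ℚ.+-identityˡ 0ℚ)

Σ<-guarded-0 : ∀ n (p : ℕ → Bool) → Σ< n (λ i → if p i then 0ℚ else 0ℚ) ≡ 0ℚ
Σ<-guarded-0 n p = Σ<-zero n (λ {i} _ → guarded (p i))
  where
  guarded : ∀ b → (if b then 0ℚ else 0ℚ) ≡ 0ℚ
  guarded true  = refl
  guarded false = refl

Σ<-guarded-scaled : ∀ n (p : ℕ → Bool) b c (f : ℕ → ℚ) →
  Σ< n (λ i → if p i then (if b then c * f i else 0ℚ) else 0ℚ) ≡ c * (if b then Σ< n (λ i → if p i then f i else 0ℚ) else 0ℚ)
Σ<-guarded-scaled n p true  c f = trans (Σ<-cong n (λ {i} _ → guarded (p i))) (Σ<-*ˡ n c (λ i → if p i then f i else 0ℚ))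
  where
  guarded : ∀ {i} b → (if b then c * f i else 0ℚ) ≡ c * (if b then f i else 0ℚ)
  guarded true  = refl
  guarded false = sym (ℚ.*-zeroʳ c)
Σ<-guarded-scaled n p false c f = trans (Σ<-guarded-0 n p) (sym (ℚ.*-zeroʳ c))

-- Each term (t, s) is sorted into the slot φ t s; after swapping the sums, slot j receives only the
-- term of its unique preimage.
module _ {A B : ℕ} {P : ℕ → ℕ → Set} (P? : ∀ t s → Dec (P t s)) {Q : ℕ → Set} (Q? : ∀ j → Dec (Q j))
         {F : ℕ → ℕ → ℚ} {g : ℕ → ℚ} (φ : ℕ → ℕ → ℕ)
         (maps-to : ∀ {t s} → P t s → φ t s < B × Q (φ t s) × F t s ≡ g (φ t s))
         (injective : ∀ {t s t′ s′} → P t s → P t′ s′ → φ t s ≡ φ t′ s′ → t ≡ t′ × s ≡ s′)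
         (onto : ∀ {j} → j < B → Q j → ∃₂ λ t s → s < t × t < A × P t s × φ t s ≡ j) where

  private
    sorted? : ∀ t s j → Dec (P t s × φ t s ≡ j)
    sorted? t s j = P? t s ×-dec (φ t s ≟ j)

    sorted : ℕ → ℕ → ℕ → ℚ
    sorted t s j = if does (sorted? t s j) then F t s else 0ℚ

    spread : ∀ t s → (if does (P? t s) then F t s else 0ℚ) ≡ Σ< B (sorted t s)
    spread t s = [ spread-yes , spread-no ]′ (toSum (P? t s))
      where
      spread-yes : P t s → (if does (P? t s) then F t s else 0ℚ) ≡ Σ< B (sorted t s)
      spread-yes p = begin
        (if does (P? t s) then F t s else 0ℚ) ≡⟨ if-yes (P? t s) p ⟩
        F t s                                 ≡⟨ if-yes (sorted? t s (φ t s)) (p , refl) ⟨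
        sorted t s (φ t s)                    ≡⟨ Σ<-single (proj₁ (maps-to p)) elsewhere ⟨
        Σ< B (sorted t s)                     ∎
        where
        elsewhere : ∀ {j} → j < B → j ≢ φ t s → sorted t s j ≡ 0ℚ
        elsewhere {j} _ j≢φ = if-no (sorted? t s j) (j≢φ ∘ sym ∘ proj₂)
      spread-no : ¬ P t s → (if does (P? t s) then F t s else 0ℚ) ≡ Σ< B (sorted t s)
      spread-no ¬p = trans (if-no (P? t s) ¬p) (sym (Σ<-zero B λ {j} _ → if-no (sorted? t s j) (¬p ∘ proj₁)))

    collect : ∀ {j} → j < B → Σ< A (λ t → Σ< t (λ s → sorted t s j)) ≡ (if does (Q? j) then g j else 0ℚ)
    collect {j} j<B with Q? j
    ... | no ¬q = Σ<Σ<-zero A λ {t} {s} _ _ →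
      if-no (sorted? t s j) (λ (p , φ≡j) → ¬q (subst Q φ≡j (proj₁ (proj₂ (maps-to p)))))
    ... | yes q with onto j<B q
    ... | t₀ , s₀ , s₀<t₀ , t₀<A , p₀ , φ₀≡j = begin
      Σ< A (λ t → Σ< t (λ s → sorted t s j))
        ≡⟨ Σ<Σ<-single s₀<t₀ t₀<A (λ {t} {s} _ _ ≢₀ → if-no (sorted? t s j)
             λ (p , φ≡j) → ≢₀ (injective p p₀ (trans φ≡j (sym φ₀≡j)))) ⟩
      sorted t₀ s₀ j  ≡⟨ if-yes (sorted? t₀ s₀ j) (p₀ , φ₀≡j) ⟩
      F t₀ s₀         ≡⟨ proj₂ (proj₂ (maps-to p₀)) ⟩
      g (φ t₀ s₀)     ≡⟨ cong g φ₀≡j ⟩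
      g j             ∎

  Σ<Σ<-reindex : Σ< A (λ t → Σ< t (λ s → if does (P? t s) then F t s else 0ℚ))
               ≡ Σ< B (λ j → if does (Q? j) then g j else 0ℚ)
  Σ<Σ<-reindex = begin
    Σ< A (λ t → Σ< t (λ s → if does (P? t s) then F t s else 0ℚ))
      ≡⟨ Σ<-cong A (λ {t} _ → Σ<-cong t (λ {s} _ → spread t s)) ⟩
    Σ< A (λ t → Σ< t (λ s → Σ< B (sorted t s)))
      ≡⟨ Σ<-cong A (λ {t} _ → Σ<-comm t B (sorted t)) ⟩
    Σ< A (λ t → Σ< B (λ j → Σ< t (λ s → sorted t s j)))
      ≡⟨ Σ<-comm A B (λ t j → Σ< t (λ s → sorted t s j)) ⟩
    Σ< B (λ j → Σ< A (λ t → Σ< t (λ s → sorted t s j)))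
      ≡⟨ Σ<-cong B collect ⟩
    Σ< B (λ j → if does (Q? j) then g j else 0ℚ) ∎

-- The sign count Σ±

private
  signs : Bool → Bool → ℚ → ℚ
  signs b₁ b₂ V = (if b₁ then V else 0ℚ) + (if b₂ then V else 0ℚ)

  signs-equal : ∀ b V → signs b b V ≡ (if b then V + V else 0ℚ)
  signs-equal true  V = refl
  signs-equal false V = ℚ.+-identityˡ 0ℚ

  signs-exclusive : ∀ b₁ b₂ V → (b₁ ≡ true → b₂ ≡ true → ⊥) → signs b₁ b₂ V ≡ (if b₁ ∨ b₂ then V else 0ℚ)
  signs-exclusive true  true  V not-both = ⊥-elim (not-both refl refl)
  signs-exclusive true  false V _        = ℚ.+-identityʳ V
  signs-exclusive false true  V _        = ℚ.+-identityˡ V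
  signs-exclusive false false V _        = ℚ.+-identityˡ 0ℚ

Σ±-cong : ∀ {x m m′ M V} → m ≈ m′ [mod M ] → Σ± x m M V ≡ Σ± x m′ M V
Σ±-cong {x} {V = V} m≈m′ = cong₂ (λ b₁ b₂ → signs b₁ b₂ V)
  (≡[mod]-cong (≈-refl {+ x}) m≈m′) (≡[mod]-cong (≈-refl {+ x}) (≈-neg m≈m′))

Σ±-neg : ∀ {x m M V} → Σ± x (ℤ.- m) M V ≡ Σ± x m M V
Σ±-neg {x} {m} {M} {V} = begin
  signs ((+ x) ≡ ℤ.- m [mod M ]) ((+ x) ≡ ℤ.- ℤ.- m [mod M ]) V
    ≡⟨ cong (λ k → signs ((+ x) ≡ ℤ.- m [mod M ]) ((+ x) ≡ k [mod M ]) V) (ℤ.neg-involutive m) ⟩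
  signs ((+ x) ≡ ℤ.- m [mod M ]) ((+ x) ≡ m [mod M ]) V
    ≡⟨ ℚ.+-comm (if (+ x) ≡ ℤ.- m [mod M ] then V else 0ℚ) (if (+ x) ≡ m [mod M ] then V else 0ℚ) ⟩
  signs ((+ x) ≡ m [mod M ]) ((+ x) ≡ ℤ.- m [mod M ]) V ∎

Σ±-self-conjugate : ∀ {x m M V} → ℤ.- m ≈ m [mod M ] → Σ± x m M V ≡ (if (+ x) ≡ m [mod M ] then V + V else 0ℚ)
Σ±-self-conjugate {x} {m} {M} {V} -m≈m = trans
  (cong (λ b → signs ((+ x) ≡ m [mod M ]) b V) (≡[mod]-cong (≈-refl {+ x}) -m≈m))
  (signs-equal ((+ x) ≡ m [mod M ]) V)

Σ±-distinct-conjugates : ∀ {x m M V} → ¬ (m ≈ ℤ.- m [mod M ]) →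
  Σ± x m M V ≡ (if (+ x) ≡ m [mod M ] ∨ (+ x) ≡ ℤ.- m [mod M ] then V else 0ℚ)
Σ±-distinct-conjugates {x} {m} {M} {V} m≉-m = signs-exclusive ((+ x) ≡ m [mod M ]) ((+ x) ≡ ℤ.- m [mod M ]) V
  λ x≡m x≡-m → m≉-m (≈-trans (≈-sym (≡[mod]-sound {+ x} {m} x≡m)) (≡[mod]-sound {+ x} {ℤ.- m} x≡-m))

Σ±-parity : ∀ {x m M V} → 2 ∣ M → 2 ∣ x → ¬ 2 ∣ ∣ m ∣ → Σ± x m M V ≡ 0ℚ
Σ±-parity {x} {m} {M} {V} 2∣M 2∣x 2∤m = trans
  (cong₂ (λ b₁ b₂ → signs b₁ b₂ V) (≡[mod]-parity {c = m} 2∣M 2∣x 2∤m)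
                                   (≡[mod]-parity {c = ℤ.- m} 2∣M 2∣x (subst (¬_ ∘ (2 ∣_)) (sym (ℤ.∣-i∣≡∣i∣ m)) 2∤m)))
  (ℚ.+-identityˡ 0ℚ)

Σ±-odd-mod-4 : ∀ {d V} → ¬ 2 ∣ d → Σ± d (+ 1) 4 V ≡ V
Σ±-odd-mod-4 {d} {V} 2∤d = trans (Σ±-distinct-conjugates {d} {+ 1} {4} {V} λ (congruent 4∣2) → from-no (4 ∣? 2) 4∣2)
                                  (cong (λ b → if b then V else 0ℚ) (odd≡±1[mod4] 2∤d))

ℕtoℚ-* : ∀ a b → ℕtoℚ (a ℕ.* b) ≡ ℕtoℚ a * ℕtoℚ b
ℕtoℚ-* a b = ℚ.toℚᵘ-injective (ℚᵘ.≃-trans (as-ℚᵘ (a ℕ.* b)) (ℚᵘ.≃-trans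
  (ℚᵘ.*≡* (cong (ℤ._* + 1) (ℤ.pos-* a b)))
  (ℚᵘ.≃-sym (ℚᵘ.≃-trans (ℚ.toℚᵘ-homo-* (ℕtoℚ a) (ℕtoℚ b)) (ℚᵘ.*-cong (as-ℚᵘ a) (as-ℚᵘ b))))))
  where
  as-ℚᵘ : ∀ k → ℚ.toℚᵘ (ℕtoℚ k) ℚᵘ.≃ ℚᵘ.mkℚᵘ (+ k) 0
  as-ℚᵘ k = ℚ.toℚᵘ-fromℚᵘ (ℚᵘ.mkℚᵘ (+ k) 0)

ℕtoℚ-2^ : ∀ d ℓ → ℕtoℚ ((2 ℕ.* d) ^ ℓ) ≡ pow2 ℓ * ℕtoℚ (d ^ ℓ)
ℕtoℚ-2^ d ℓ = trans (cong ℕtoℚ (^-distrib-* 2 d ℓ)) (ℕtoℚ-* (2 ^ ℓ) (d ^ ℓ))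

-- The last step uses that ℕtoℚ 2 evaluates to 1ℚ + 1ℚ.
pow2-doubling : ∀ ℓ x → pow2 ℓ * x + pow2 ℓ * x ≡ pow2 (suc ℓ) * x
pow2-doubling ℓ x = begin
  pow2 ℓ * x + pow2 ℓ * x       ≡⟨ ℚ.*-distribʳ-+ x (pow2 ℓ) (pow2 ℓ) ⟨
  (pow2 ℓ + pow2 ℓ) * x         ≡⟨ cong (λ y → (y + pow2 ℓ) * x) (ℚ.*-identityˡ (pow2 ℓ)) ⟨
  (1ℚ * pow2 ℓ + pow2 ℓ) * x    ≡⟨ cong (λ y → (1ℚ * pow2 ℓ + y) * x) (ℚ.*-identityˡ (pow2 ℓ)) ⟨
  (1ℚ * pow2 ℓ + 1ℚ * pow2 ℓ) * x ≡⟨ cong (_* x) (ℚ.*-distribʳ-+ (pow2 ℓ) 1ℚ 1ℚ) ⟨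
  ((1ℚ + 1ℚ) * pow2 ℓ) * x      ≡⟨ cong (_* x) (ℕtoℚ-* 2 (2 ^ ℓ)) ⟨
  pow2 (suc ℓ) * x              ∎

-- λ(4n) as a sum over divisors

SmallDivisor : ℕ → ℕ → Set
SmallDivisor n d = 0 < d × d ∣ n × d ℕ.* d < n

smallDivisor? : ∀ n d → Dec (SmallDivisor n d)
smallDivisor? n d = (0 <? d) ×-dec (d ∣? n) ×-dec (d ℕ.* d <? n)

SquareRoot : ℕ → ℕ → Set
SquareRoot n j = 0 < j × j ℕ.* j ≡ n

squareRoot? : ∀ n j → Dec (SquareRoot n j)
squareRoot? n j = (0 <? j) ×-dec (j ℕ.* j ≟ n)

Represents : ℕ → ℕ → ℕ → Set
Represents n t s = t ℕ.* t ≡ s ℕ.* s ℕ.+ 4 ℕ.* n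

representation⇒small-divisor : ∀ {n t s} .{{_ : NonZero n}} → Represents n t s → ¬ s ≡ 0 →
                               half-gap t s < suc n × SmallDivisor n (half-gap t s)
representation⇒small-divisor {n} {t} {s} t²≡ s≢0 = s<s (∣⇒≤ d∣n) , 0<d , d∣n , d²<n
  where
  d = half-gap t s
  d[d+s]≡n = proj₂ (representation⇒factorisation {t} {s} {n} t²≡)
  0<d = factor-positive {d} {d ℕ.+ s} d[d+s]≡n
  d∣n : d ∣ n
  d∣n = divides (d ℕ.+ s) (trans (sym d[d+s]≡n) (ℕ.*-comm d (d ℕ.+ s)))
  d²<n : d ℕ.* d < n
  d²<n = subst (d ℕ.* d <_) d[d+s]≡n (ℕ.*-monoʳ-< d {{>-nonZero 0<d}} (ℕ.m<m+n d (ℕ.n≢0⇒n>0 s≢0)))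

representation⇒square-root : ∀ {n t} .{{_ : NonZero n}} → Represents n t 0 →
                             half-gap t 0 < suc n × SquareRoot n (half-gap t 0)
representation⇒square-root {n} {t} t²≡ = s<s (subst (d ≤_) d²≡n (ℕ.m≤m*n d d {{>-nonZero 0<d}})) , 0<d , d²≡n
  where
  d = half-gap t 0
  d[d+0]≡n = proj₂ (representation⇒factorisation {t} {0} {n} t²≡)
  0<d = factor-positive {d} {d ℕ.+ 0} d[d+0]≡n
  d²≡n : d ℕ.* d ≡ n
  d²≡n = trans (cong (ℕ._*_ d) (sym (ℕ.+-identityʳ d))) d[d+0]≡n

small-divisor⇒representation : ∀ {n d} → SmallDivisor n d →
  ∃₂ λ t s → s < t × t < suc (4 ℕ.* n) × (Represents n t s × ¬ s ≡ 0) × half-gap t s ≡ d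
small-divisor⇒representation {n} {d} (0<d , divides e n≡ed , d²<n) =
  _ , e ∸ d , proj₁ rep , proj₁ (proj₂ rep) , (proj₂ (proj₂ rep) , ℕ.>⇒≢ (ℕ.m<n⇒0<n∸m d<e)) , half-gap-s+2d (e ∸ d) d
  where
  d<e : d < e
  d<e = ℕ.*-cancelˡ-< d d e (subst (d ℕ.* d <_) (trans n≡ed (ℕ.*-comm e d)) d²<n)
  rep = factorisation⇒representation {d} {e ∸ d} {n} 0<d
          (trans (cong (ℕ._*_ d) (ℕ.m+[n∸m]≡n (ℕ.<⇒≤ d<e))) (trans (ℕ.*-comm d e) (sym n≡ed)))

square-root⇒representation : ∀ {n j} → SquareRoot n j →
  ∃₂ λ t s → s < t × t < suc (4 ℕ.* n) × (Represents n t s × s ≡ 0) × half-gap t s ≡ j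
square-root⇒representation {n} {j} (0<j , j²≡n) =
  _ , 0 , proj₁ rep , proj₁ (proj₂ rep) , (proj₂ (proj₂ rep) , refl) , half-gap-s+2d 0 j
  where
  rep = factorisation⇒representation {j} {0} {n} 0<j (trans (cong (ℕ._*_ j) (ℕ.+-identityʳ j)) j²≡n)

lam-4n : ∀ ℓ m M n .{{_ : NonZero n}} {g h : ℕ → ℚ} →
  (∀ {d e} → d < e → d ℕ.* e ≡ n → Σ± (d ℕ.+ e) m M (pow2 ℓ * ℕtoℚ (d ^ ℓ)) ≡ g d) →
  (∀ j → j ℕ.* j ≡ n → Σ± (j ℕ.+ j) m M (pow2m1 ℓ * ℕtoℚ (j ^ ℓ)) ≡ h j) →
  lam ℓ m M (4 ℕ.* n) ≡ Σ< (suc n) (λ d → if does (smallDivisor? n d) then g d else 0ℚ)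
                      + Σ< (suc n) (λ j → if does (squareRoot? n j) then h j else 0ℚ)
lam-4n ℓ m M n@(suc _) {g} {h} cofactors roots = begin
  lam ℓ m M (4 ℕ.* n)
    ≡⟨ Σ<-cong (suc (4 ℕ.* n)) (λ {t} _ → Σ<-cong t (λ {s} _ → if-split (represents? t s) (s ≟ 0))) ⟩
  Σ< (suc (4 ℕ.* n)) (λ t → Σ< t (λ s → summand₊ t s + summand₀ t s))
    ≡⟨ Σ<Σ<-+ (suc (4 ℕ.* n)) summand₊ summand₀ ⟩
  Σ< (suc (4 ℕ.* n)) (λ t → Σ< t (summand₊ t)) + Σ< (suc (4 ℕ.* n)) (λ t → Σ< t (summand₀ t))
    ≡⟨ cong₂ _+_ (Σ<Σ<-reindex (λ t s → represents? t s ×-dec ¬? (s ≟ 0)) (smallDivisor? n) half-gap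
                               maps-to₊ (injective {λ s → ¬ s ≡ 0}) (λ _ → small-divisor⇒representation))
                 (Σ<Σ<-reindex (λ t s → represents? t s ×-dec (s ≟ 0)) (squareRoot? n) half-gap
                               maps-to₀ (injective {_≡ 0}) (λ _ → square-root⇒representation)) ⟩
  Σ< (suc n) (λ d → if does (smallDivisor? n d) then g d else 0ℚ)
    + Σ< (suc n) (λ j → if does (squareRoot? n j) then h j else 0ℚ) ∎
  where
  f : ℕ → ℕ → ℚ
  f t s = Σ± t m M ((if does (s ≟ 0) then ½ else 1ℚ) * ℕtoℚ ((t ∸ s) ^ ℓ))

  represents? : ∀ t s → Dec (Represents n t s)
  represents? t s = t ℕ.* t ≟ s ℕ.* s ℕ.+ 4 ℕ.* n

  summand₊ summand₀ : ℕ → ℕ → ℚ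
  summand₊ t s = if does (represents? t s ×-dec ¬? (s ≟ 0)) then f t s else 0ℚ
  summand₀ t s = if does (represents? t s ×-dec (s ≟ 0)) then f t s else 0ℚ

  injective : ∀ {Q : ℕ → Set} {t s t′ s′} → Represents n t s × Q s → Represents n t′ s′ × Q s′ →
              half-gap t s ≡ half-gap t′ s′ → t ≡ t′ × s ≡ s′
  injective {t = t} {s} {t′} {s′} (t²≡ , _) (t′²≡ , _) = half-gap-injective {t} {s} {t′} {s′} t²≡ t′²≡

  maps-to₊ : ∀ {t s} → Represents n t s × ¬ s ≡ 0 →
             half-gap t s < suc n × SmallDivisor n (half-gap t s) × f t s ≡ g (half-gap t s)
  maps-to₊ {t} {s} (t²≡ , s≢0) = proj₁ divisor , proj₂ divisor , (begin
    f t s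
      ≡⟨ cong (λ w → Σ± t m M (w * ℕtoℚ ((t ∸ s) ^ ℓ))) (if-no (s ≟ 0) s≢0) ⟩
    Σ± t m M (1ℚ * ℕtoℚ ((t ∸ s) ^ ℓ))
      ≡⟨ cong (Σ± t m M) (ℚ.*-identityˡ (ℕtoℚ ((t ∸ s) ^ ℓ))) ⟩
    Σ± t m M (ℕtoℚ ((t ∸ s) ^ ℓ))
      ≡⟨ cong (λ u → Σ± t m M (ℕtoℚ (u ^ ℓ))) (trans (cong (_∸ s) t≡s+2d) (ℕ.m+n∸m≡n s (2 ℕ.* d))) ⟩
    Σ± t m M (ℕtoℚ ((2 ℕ.* d) ^ ℓ))
      ≡⟨ cong (Σ± t m M) (ℕtoℚ-2^ d ℓ) ⟩
    Σ± t m M (pow2 ℓ * ℕtoℚ (d ^ ℓ))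
      ≡⟨ cong (λ x → Σ± x m M (pow2 ℓ * ℕtoℚ (d ^ ℓ))) (trans t≡s+2d (s+2d≡d+[d+s] s d)) ⟩
    Σ± (d ℕ.+ (d ℕ.+ s)) m M (pow2 ℓ * ℕtoℚ (d ^ ℓ))
      ≡⟨ cofactors (ℕ.m<m+n d (ℕ.n≢0⇒n>0 s≢0)) d[d+s]≡n ⟩
    g d ∎)
    where
    d = half-gap t s
    divisor = representation⇒small-divisor {n} {t} {s} t²≡ s≢0
    t≡s+2d = proj₁ (representation⇒factorisation {t} {s} {n} t²≡)
    d[d+s]≡n = proj₂ (representation⇒factorisation {t} {s} {n} t²≡)

  maps-to₀ : ∀ {t s} → Represents n t s × s ≡ 0 →
             half-gap t s < suc n × SquareRoot n (half-gap t s) × f t s ≡ h (half-gap t s)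
  maps-to₀ {t} (t²≡ , refl) = proj₁ root , proj₂ root , (begin
    Σ± t m M (½ * ℕtoℚ (t ^ ℓ))
      ≡⟨ cong (λ x → Σ± x m M (½ * ℕtoℚ (x ^ ℓ))) t≡2d ⟩
    Σ± (2 ℕ.* d) m M (½ * ℕtoℚ ((2 ℕ.* d) ^ ℓ))
      ≡⟨ cong (λ v → Σ± (2 ℕ.* d) m M (½ * v)) (ℕtoℚ-2^ d ℓ) ⟩
    Σ± (2 ℕ.* d) m M (½ * (pow2 ℓ * ℕtoℚ (d ^ ℓ)))
      ≡⟨ cong (Σ± (2 ℕ.* d) m M) (ℚ.*-assoc ½ (pow2 ℓ) (ℕtoℚ (d ^ ℓ))) ⟨
    Σ± (2 ℕ.* d) m M (pow2m1 ℓ * ℕtoℚ (d ^ ℓ))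
      ≡⟨ cong (λ x → Σ± x m M (pow2m1 ℓ * ℕtoℚ (d ^ ℓ))) (cong (ℕ._+_ d) (ℕ.+-identityʳ d)) ⟩
    Σ± (d ℕ.+ d) m M (pow2m1 ℓ * ℕtoℚ (d ^ ℓ))
      ≡⟨ roots d (proj₂ (proj₂ root)) ⟩
    h d ∎)
    where
    d = half-gap t 0
    root = representation⇒square-root {n} {t} t²≡
    t≡2d = proj₁ (representation⇒factorisation {t} {0} {n} t²≡)

lam-cong : ∀ {ℓ m m′ M} → (∀ {t V} → Σ± t m M V ≡ Σ± t m′ M V) → ∀ k → lam ℓ m M k ≡ lam ℓ m′ M k
lam-cong Σ±≡ zero    = refl
lam-cong {ℓ} Σ±≡ (suc k) = Σ<-cong (suc (suc k)) λ {t} _ → Σ<-cong t λ {s} _ →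
  cong (λ v → if does (t ℕ.* t ≟ s ℕ.* s ℕ.+ suc k) then v else 0ℚ)
       (Σ±≡ {t} {(if does (s ≟ 0) then ½ else 1ℚ) * ℕtoℚ ((t ∸ s) ^ ℓ)})

lam-%ℕ : ∀ ℓ m M .{{_ : NonZero M}} k → lam ℓ m M k ≡ lam ℓ (+ (m %ℕ M)) M k
lam-%ℕ ℓ m M = lam-cong (λ {t} {V} → Σ±-cong {t} {m} {+ (m %ℕ M)} {M} {V} (%ℕ-congruent m M))

scaled-G-sum : ∀ ℓ n .{{_ : NonZero n}} c b →
  Σ< (suc n) (λ d → if does (smallDivisor? n d) then (if b then c * Σ± d (+ 1) 4 (ℕtoℚ (d ^ ℓ)) else 0ℚ) else 0ℚ)
    ≡ c * (if b then G ℓ (+ 1) 4 n else 0ℚ)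
scaled-G-sum ℓ n@(suc _) c b = Σ<-guarded-scaled (suc n) (does ∘ smallDivisor? n) b c (λ d → Σ± d (+ 1) 4 (ℕtoℚ (d ^ ℓ)))

scaled-T-sum : ∀ ℓ n c →
  Σ< (suc n) (λ j → if does (squareRoot? n j) then c * Σ± j (+ 1) 4 (ℕtoℚ (j ^ ℓ)) else 0ℚ) ≡ c * T ℓ (+ 1) 4 n
scaled-T-sum ℓ n c = Σ<-guarded-scaled (suc n) (does ∘ squareRoot? n) true c (λ j → Σ± j (+ 1) 4 (ℕtoℚ (j ^ ℓ)))

-- The classes of m modulo 8

lam-4n-self-conjugate : ∀ ℓ r c n .{{_ : NonZero n}} → ¬ 2 ∣ n → ℤ.- + r ≈ + r [mod 8 ] →
  (∀ {d e} → ¬ 2 ∣ d → ¬ 2 ∣ e → ((+ (d ℕ.+ e)) ≡ + r [mod 8 ]) ≡ ((+ (d ℕ.* e)) ≡ + c [mod 8 ])) →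
  ((+ 1) ≡ + c [mod 8 ]) ≡ false →
  lam ℓ (+ r) 8 (4 ℕ.* n) ≡ pow2 (suc ℓ) * (G ℓ (+ 1) 4 ∣S[ 8 , + c ]) n
lam-4n-self-conjugate ℓ r c n 2∤n -r≈r sum-law 1≢c = begin
  lam ℓ (+ r) 8 (4 ℕ.* n)
    ≡⟨ lam-4n ℓ (+ r) 8 n {g} {λ _ → 0ℚ} cofactors roots ⟩
  Σ< (suc n) (λ d → if does (smallDivisor? n d) then g d else 0ℚ) + Σ< (suc n) (λ j → if does (squareRoot? n j) then 0ℚ else 0ℚ)
    ≡⟨ cong₂ _+_ (scaled-G-sum ℓ n (pow2 (suc ℓ)) class) (Σ<-guarded-0 (suc n) (does ∘ squareRoot? n)) ⟩
  pow2 (suc ℓ) * (G ℓ (+ 1) 4 ∣S[ 8 , + c ]) n + 0ℚ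
    ≡⟨ ℚ.+-identityʳ (pow2 (suc ℓ) * (G ℓ (+ 1) 4 ∣S[ 8 , + c ]) n) ⟩
  pow2 (suc ℓ) * (G ℓ (+ 1) 4 ∣S[ 8 , + c ]) n ∎
  where
  class : Bool
  class = (+ n) ≡ + c [mod 8 ]

  D g : ℕ → ℚ
  D d = pow2 ℓ * ℕtoℚ (d ^ ℓ)
  g d = if class then pow2 (suc ℓ) * Σ± d (+ 1) 4 (ℕtoℚ (d ^ ℓ)) else 0ℚ

  cofactors : ∀ {d e} → d < e → d ℕ.* e ≡ n → Σ± (d ℕ.+ e) (+ r) 8 (D d) ≡ g d
  cofactors {d} {e} _ de≡n = begin
    Σ± (d ℕ.+ e) (+ r) 8 (D d)
      ≡⟨ Σ±-self-conjugate {d ℕ.+ e} {+ r} {8} {D d} -r≈r ⟩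
    (if (+ (d ℕ.+ e)) ≡ + r [mod 8 ] then D d + D d else 0ℚ)
      ≡⟨ cong (λ b → if b then D d + D d else 0ℚ) (trans (sum-law 2∤d 2∤e) (cong (λ k → (+ k) ≡ + c [mod 8 ]) de≡n)) ⟩
    (if class then D d + D d else 0ℚ)
      ≡⟨ cong (λ x → if class then x else 0ℚ) (trans (pow2-doubling ℓ (ℕtoℚ (d ^ ℓ))) (cong (pow2 (suc ℓ) *_) (sym (Σ±-odd-mod-4 2∤d)))) ⟩
    g d ∎
    where
    2∤d = proj₁ (odd-factors {d} {e} 2∤n de≡n)
    2∤e = proj₂ (odd-factors {d} {e} 2∤n de≡n)

  roots : ∀ j → j ℕ.* j ≡ n → Σ± (j ℕ.+ j) (+ r) 8 (pow2m1 ℓ * ℕtoℚ (j ^ ℓ)) ≡ 0ℚ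
  roots j j²≡n = trans (Σ±-self-conjugate {j ℕ.+ j} {+ r} {8} {W} -r≈r) (cong (λ b → if b then W + W else 0ℚ)
    (trans (sum-law 2∤j 2∤j) (trans (odd-square-≡[mod] {j} {8} {+ c} 2∤j ∣-refl) 1≢c)))
    where
    W = pow2m1 ℓ * ℕtoℚ (j ^ ℓ)
    2∤j = proj₁ (odd-factors {j} {j} 2∤n j²≡n)

lam-4n-class-2 : ∀ ℓ n .{{_ : NonZero n}} → ¬ 2 ∣ n →
  lam ℓ (+ 2) 8 (4 ℕ.* n) ≡ pow2 ℓ * (G ℓ (+ 1) 4 ∣S[ 4 , + 1 ]) n + pow2m1 ℓ * T ℓ (+ 1) 4 n
lam-4n-class-2 ℓ n 2∤n = begin
  lam ℓ (+ 2) 8 (4 ℕ.* n)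
    ≡⟨ lam-4n ℓ (+ 2) 8 n {g} {h} cofactors roots ⟩
  Σ< (suc n) (λ d → if does (smallDivisor? n d) then g d else 0ℚ) + Σ< (suc n) (λ j → if does (squareRoot? n j) then h j else 0ℚ)
    ≡⟨ cong₂ _+_ (scaled-G-sum ℓ n (pow2 ℓ) class) (scaled-T-sum ℓ n (pow2m1 ℓ)) ⟩
  pow2 ℓ * (G ℓ (+ 1) 4 ∣S[ 4 , + 1 ]) n + pow2m1 ℓ * T ℓ (+ 1) 4 n ∎
  where
  class : Bool
  class = (+ n) ≡ + 1 [mod 4 ]

  D g h : ℕ → ℚ
  D d = pow2 ℓ * ℕtoℚ (d ^ ℓ)
  g d = if class then pow2 ℓ * Σ± d (+ 1) 4 (ℕtoℚ (d ^ ℓ)) else 0ℚ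
  h j = pow2m1 ℓ * Σ± j (+ 1) 4 (ℕtoℚ (j ^ ℓ))

  2≉-2 : ¬ (+ 2 ≈ ℤ.- + 2 [mod 8 ])
  2≉-2 (congruent 8∣4) = from-no (8 ∣? 4) 8∣4

  cofactors : ∀ {d e} → d < e → d ℕ.* e ≡ n → Σ± (d ℕ.+ e) (+ 2) 8 (D d) ≡ g d
  cofactors {d} {e} _ de≡n = begin
    Σ± (d ℕ.+ e) (+ 2) 8 (D d)
      ≡⟨ Σ±-distinct-conjugates {d ℕ.+ e} {+ 2} {8} {D d} 2≉-2 ⟩
    (if (+ (d ℕ.+ e)) ≡ + 2 [mod 8 ] ∨ (+ (d ℕ.+ e)) ≡ ℤ.- + 2 [mod 8 ] then D d else 0ℚ)
      ≡⟨ cong (λ b → if b then D d else 0ℚ) (trans (odd-pair-sum≡±2[mod8] 2∤d 2∤e) (cong (λ k → (+ k) ≡ + 1 [mod 4 ]) de≡n)) ⟩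
    (if class then D d else 0ℚ)
      ≡⟨ cong (λ x → if class then x else 0ℚ) (cong (pow2 ℓ *_) (sym (Σ±-odd-mod-4 2∤d))) ⟩
    g d ∎
    where
    2∤d = proj₁ (odd-factors {d} {e} 2∤n de≡n)
    2∤e = proj₂ (odd-factors {d} {e} 2∤n de≡n)

  roots : ∀ j → j ℕ.* j ≡ n → Σ± (j ℕ.+ j) (+ 2) 8 (pow2m1 ℓ * ℕtoℚ (j ^ ℓ)) ≡ h j
  roots j j²≡n = begin
    Σ± (j ℕ.+ j) (+ 2) 8 W
      ≡⟨ Σ±-distinct-conjugates {j ℕ.+ j} {+ 2} {8} {W} 2≉-2 ⟩
    (if (+ (j ℕ.+ j)) ≡ + 2 [mod 8 ] ∨ (+ (j ℕ.+ j)) ≡ ℤ.- + 2 [mod 8 ] then W else 0ℚ)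
      ≡⟨ cong (λ b → if b then W else 0ℚ) (trans (odd-pair-sum≡±2[mod8] 2∤j 2∤j) (odd-square-≡[mod] {j} {4} {+ 1} 2∤j (divides 2 refl))) ⟩
    W
      ≡⟨ cong (pow2m1 ℓ *_) (Σ±-odd-mod-4 2∤j) ⟨
    h j ∎
    where
    W = pow2m1 ℓ * ℕtoℚ (j ^ ℓ)
    2∤j = proj₁ (odd-factors {j} {j} 2∤n j²≡n)

lam-4n-odd-class : ∀ ℓ r n .{{_ : NonZero n}} → ¬ 2 ∣ n → ¬ 2 ∣ r → lam ℓ (+ r) 8 (4 ℕ.* n) ≡ 0ℚ
lam-4n-odd-class ℓ r n 2∤n 2∤r = begin
  lam ℓ (+ r) 8 (4 ℕ.* n)
    ≡⟨ lam-4n ℓ (+ r) 8 n {λ _ → 0ℚ} {λ _ → 0ℚ} cofactors roots ⟩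
  Σ< (suc n) (λ d → if does (smallDivisor? n d) then 0ℚ else 0ℚ) + Σ< (suc n) (λ j → if does (squareRoot? n j) then 0ℚ else 0ℚ)
    ≡⟨ cong₂ _+_ (Σ<-guarded-0 (suc n) (does ∘ smallDivisor? n)) (Σ<-guarded-0 (suc n) (does ∘ squareRoot? n)) ⟩
  0ℚ + 0ℚ
    ≡⟨ ℚ.+-identityˡ 0ℚ ⟩
  0ℚ ∎
  where
  cofactors : ∀ {d e} → d < e → d ℕ.* e ≡ n → Σ± (d ℕ.+ e) (+ r) 8 (pow2 ℓ * ℕtoℚ (d ^ ℓ)) ≡ 0ℚ
  cofactors {d} {e} _ de≡n = Σ±-parity {d ℕ.+ e} {+ r} {8} {pow2 ℓ * ℕtoℚ (d ^ ℓ)} (divides 4 refl)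
                                       (uncurry odd+odd (odd-factors {d} {e} 2∤n de≡n)) 2∤r
  roots : ∀ j → j ℕ.* j ≡ n → Σ± (j ℕ.+ j) (+ r) 8 (pow2m1 ℓ * ℕtoℚ (j ^ ℓ)) ≡ 0ℚ
  roots j j²≡n = Σ±-parity {j ℕ.+ j} {+ r} {8} {pow2m1 ℓ * ℕtoℚ (j ^ ℓ)} (divides 4 refl)
                             (uncurry odd+odd (odd-factors {j} {j} 2∤n j²≡n)) 2∤r

T-even : ∀ ℓ {n} → 2 ∣ n → T ℓ (+ 1) 4 n ≡ 0ℚ
T-even ℓ {n} 2∣n = Σ<-zero (suc n) λ {j} _ → [ root {j} , if-no (squareRoot? n j) ]′ (toSum (squareRoot? n j))
  where
  root : ∀ {j} → SquareRoot n j → (if does (squareRoot? n j) then Σ± j (+ 1) 4 (ℕtoℚ (j ^ ℓ)) else 0ℚ) ≡ 0ℚ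
  root {j} (0<j , j²≡n) = trans (if-yes (squareRoot? n j) (0<j , j²≡n))
    (Σ±-parity {j} {+ 1} {4} {ℕtoℚ (j ^ ℓ)} (divides 2 refl) 2∣j (from-no (2 ∣? 1)))
    where
    2∣j : 2 ∣ j
    2∣j = [ id , id ]′ (euclidsLemma j j prime[2] (subst (2 ∣_) (sym j²≡n) 2∣n))

∣S-even : ∀ {F M n c} → 2 ∣ M → 2 ∣ n → ¬ 2 ∣ c → (F ∣S[ M , + c ]) n ≡ 0ℚ
∣S-even {F} {n = n} {c} 2∣M 2∣n 2∤c = cong (λ b → if b then F n else 0ℚ) (≡[mod]-parity {c = + c} 2∣M 2∣n 2∤c)

⊗χ₈₀-even : ∀ {F n} → 2 ∣ n → (F ⊗χ₈₀) n ≡ 0ℚ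
⊗χ₈₀-even {F} {n} 2∣n = trans (cong (_* F n) (if-yes (2 ∣? n) 2∣n)) (ℚ.*-zeroˡ (F n))

⊗χ₈₀-odd : ∀ {F n} → ¬ 2 ∣ n → (F ⊗χ₈₀) n ≡ F n
⊗χ₈₀-odd {F} {n} 2∤n = trans (cong (_* F n) (if-no (2 ∣? n) 2∤n)) (ℚ.*-identityˡ (F n))

U4⊗χ₈₀-by-parity : ∀ ℓ m (R : Series) → (∀ {n} → 2 ∣ n → R n ≡ 0ℚ) →
  (∀ {n} .{{_ : NonZero n}} → ¬ 2 ∣ n → lam ℓ (+ (m %ℕ 8)) 8 (4 ℕ.* n) ≡ R n) →
  ∀ n → ((Λ ℓ m 8 ∣U 4) ⊗χ₈₀) n ≡ R n
U4⊗χ₈₀-by-parity ℓ m R even odd n = [ even-case , odd-case ]′ (toSum (2 ∣? n))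
  where
  even-case : 2 ∣ n → ((Λ ℓ m 8 ∣U 4) ⊗χ₈₀) n ≡ R n
  even-case 2∣n = trans (⊗χ₈₀-even {Λ ℓ m 8 ∣U 4} 2∣n) (sym (even 2∣n))
  odd-case : ¬ 2 ∣ n → ((Λ ℓ m 8 ∣U 4) ⊗χ₈₀) n ≡ R n
  odd-case 2∤n = trans (⊗χ₈₀-odd {Λ ℓ m 8 ∣U 4} 2∤n) (trans (lam-%ℕ ℓ m 8 (4 ℕ.* n)) (odd {{odd⇒nonZero 2∤n}} 2∤n))

Λ-self-conjugate-class : ∀ ℓ m {r c} → m %ℕ 8 ≡ r → ℤ.- + r ≈ + r [mod 8 ] →
  (∀ {d e} → ¬ 2 ∣ d → ¬ 2 ∣ e → ((+ (d ℕ.+ e)) ≡ + r [mod 8 ]) ≡ ((+ (d ℕ.* e)) ≡ + c [mod 8 ])) →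
  ((+ 1) ≡ + c [mod 8 ]) ≡ false → ¬ 2 ∣ c →
  ∀ n → ((Λ ℓ m 8 ∣U 4) ⊗χ₈₀) n ≡ pow2 (suc ℓ) * (G ℓ (+ 1) 4 ∣S[ 8 , + c ]) n
Λ-self-conjugate-class ℓ m {r} {c} m≡r -r≈r sum-law 1≢c 2∤c = U4⊗χ₈₀-by-parity ℓ m _
  (λ 2∣n → trans (cong (pow2 (suc ℓ) *_) (∣S-even {G ℓ (+ 1) 4} (divides 4 refl) 2∣n 2∤c)) (ℚ.*-zeroʳ (pow2 (suc ℓ))))
  (λ {n} 2∤n → trans (cong (λ k → lam ℓ (+ k) 8 (4 ℕ.* n)) m≡r) (lam-4n-self-conjugate ℓ r c n 2∤n -r≈r sum-law 1≢c))

Λ-class-2-6 : ∀ ℓ m → (m %ℕ 8 ≡ 2) ⊎ (m %ℕ 8 ≡ 6) →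
  ∀ n → ((Λ ℓ m 8 ∣U 4) ⊗χ₈₀) n ≡ pow2 ℓ * (G ℓ (+ 1) 4 ∣S[ 4 , + 1 ]) n + pow2m1 ℓ * T ℓ (+ 1) 4 n
Λ-class-2-6 ℓ m m≡2∨6 = U4⊗χ₈₀-by-parity ℓ m _
  (λ 2∣n → trans (cong₂ _+_ (cong (pow2 ℓ *_) (∣S-even {G ℓ (+ 1) 4} (divides 2 refl) 2∣n (from-no (2 ∣? 1))))
                            (cong (pow2m1 ℓ *_) (T-even ℓ 2∣n)))
                 (trans (cong₂ _+_ (ℚ.*-zeroʳ (pow2 ℓ)) (ℚ.*-zeroʳ (pow2m1 ℓ))) (ℚ.+-identityˡ 0ℚ)))
  (λ {n} 2∤n → trans (class-2 (4 ℕ.* n)) (lam-4n-class-2 ℓ n 2∤n))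
  where
  6≈-2 : + 6 ≈ ℤ.- + 2 [mod 8 ]
  6≈-2 = congruent (divides 1 refl)

  class-2 : ∀ k → lam ℓ (+ (m %ℕ 8)) 8 k ≡ lam ℓ (+ 2) 8 k
  class-2 k = [ (λ m≡2 → cong (λ r → lam ℓ (+ r) 8 k) m≡2)
              , (λ m≡6 → trans (cong (λ r → lam ℓ (+ r) 8 k) m≡6)
                               (lam-cong (λ {t} {V} → trans (Σ±-cong {t} {+ 6} {ℤ.- + 2} {8} {V} 6≈-2) (Σ±-neg {t} {+ 2} {8} {V})) k))
              ]′ m≡2∨6

Λ-odd-class : ∀ ℓ m → ¬ 2 ∣ m %ℕ 8 → ∀ n → ((Λ ℓ m 8 ∣U 4) ⊗χ₈₀) n ≡ 0ℚ
Λ-odd-class ℓ m 2∤m = U4⊗χ₈₀-by-parity ℓ m _ (λ _ → refl) (λ {n} 2∤n → lam-4n-odd-class ℓ (m %ℕ 8) n 2∤n 2∤m)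

odd-residue : ∀ {r} → (r ≡ 1) ⊎ (r ≡ 3) ⊎ (r ≡ 5) ⊎ (r ≡ 7) → ¬ 2 ∣ r
odd-residue (inj₁ refl)               = from-no (2 ∣? 1)
odd-residue (inj₂ (inj₁ refl))        = from-no (2 ∣? 3)
odd-residue (inj₂ (inj₂ (inj₁ refl))) = from-no (2 ∣? 5)
odd-residue (inj₂ (inj₂ (inj₂ refl))) = from-no (2 ∣? 7)

lemma3p4 : (ℓ : ℕ) (m : ℤ) (n : ℕ) →
    ((m %ℕ 8 ≡ 0) → ((Λ ℓ m 8 ∣U 4) ⊗χ₈₀) n ≡ pow2 (ℕ.suc ℓ) * (G ℓ (+ 1) 4 ∣S[ 8 , + 7 ]) n)
    × ((m %ℕ 8 ≡ 1) ⊎ (m %ℕ 8 ≡ 3) ⊎ (m %ℕ 8 ≡ 5) ⊎ (m %ℕ 8 ≡ 7) → ((Λ ℓ m 8 ∣U 4) ⊗χ₈₀) n ≡ 0ℚ)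
    × ((m %ℕ 8 ≡ 2) ⊎ (m %ℕ 8 ≡ 6) → ((Λ ℓ m 8 ∣U 4) ⊗χ₈₀) n ≡ pow2 ℓ * (G ℓ (+ 1) 4 ∣S[ 4 , + 1 ]) n + pow2m1 ℓ * T ℓ (+ 1) 4 n)
    × ((m %ℕ 8 ≡ 4) → ((Λ ℓ m 8 ∣U 4) ⊗χ₈₀) n ≡ pow2 (ℕ.suc ℓ) * (G ℓ (+ 1) 4 ∣S[ 8 , + 3 ]) n)
lemma3p4 ℓ m n =
    (λ m≡0 → Λ-self-conjugate-class ℓ m m≡0 ≈-refl odd-pair-sum≡0[mod8] refl (from-no (2 ∣? 7)) n)
  , (λ m-odd → Λ-odd-class ℓ m (odd-residue m-odd) n)
  , (λ m≡2∨6 → Λ-class-2-6 ℓ m m≡2∨6 n)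
  , (λ m≡4 → Λ-self-conjugate-class ℓ m m≡4 (congruent (divides 1 refl)) odd-pair-sum≡4[mod8] refl (from-no (2 ∣? 3)) n)
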